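{- For all positive integers $r,\kappa$, \[ \sum_{0\le l\le\lfloor r/2\rfloor}\ \prod_{0\le j\le l-1}\frac{(r-2j)(r-2j-1)}{(2j+2)(2\kappa+2j+1)}=2^{r}\frac{\binom{r+\kappa-1}{r}}{\binom{r+2\kappa-1}{r}}, \] where the empty product (for $l=0$) equals $1$. -}

module Defs where

open import Data.Nat using (ℕ; zero; suc; _+_; _*_; _∸_; _^_; _≤_; _<_; z≤n; s≤s; NonZero; _/_)
open import Data.Nat.Properties using (≤-refl; m≤m+n; +-suc)
open import Data.Nat.Combinatorics using (_C_; nCk+nC[k+1]≡[n+1]C[k+1]; nCn≡1)
open import Data.Integer using (ℤ; +_)
open import Data.Rational as ℚ using (ℚ; 1ℚ; 0ℚ)
open import Data.List using (List; upTo; map; foldr)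
open import Relation.Binary.PropositionalEquality using (_≡_; refl; sym; subst)

Σℚ : ℕ → (ℕ → ℚ) → ℚ
Σℚ n f = foldr ℚ._+_ 0ℚ (map f (upTo n))

Πℚ : ℕ → (ℕ → ℚ) → ℚ
Πℚ n f = foldr ℚ._*_ 1ℚ (map f (upTo n))

⟦_⟧ : ℕ → ℚ
⟦ n ⟧ = (+ n) ℚ./ 1

C-nonZero : ∀ n k → k ≤ n → NonZero (n C k)
C-nonZero zero zero z≤n = _
C-nonZero (suc n) zero z≤n = _
C-nonZero (suc n) (suc k) (s≤s k≤n)
  with C-nonZero n k k≤n
... | nz = subst NonZero (nCk+nC[k+1]≡[n+1]C[k+1] n k) (lem (n C k) (n C suc k) nz)
  where
  lem : ∀ a b → NonZero a → NonZero (a + b)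
  lem (suc a) b _ = _

r≤r+2κ-1 : ∀ r κ → r ≤ r + 2 * suc κ ∸ 1
r≤r+2κ-1 r κ = subst (r ≤_) (sym (eq r)) (m≤m+n r (κ + suc (κ + 0)))
  where
  eq : ∀ r → r + 2 * suc κ ∸ 1 ≡ r + (κ + suc (κ + 0))
  eq r rewrite +-suc r (κ + suc (κ + 0)) = refl

term : ℕ → ℕ → ℕ → ℚ
term r κ l = Πℚ l (λ j →
  (+ ((r ∸ 2 * j) * (r ∸ 2 * j ∸ 1))) ℚ./ (suc (2 * j + 1) * suc (2 * κ + 2 * j)))

r≤r+2κ∸1 : ∀ r κ → 1 ≤ κ → r ≤ r + 2 * κ ∸ 1
r≤r+2κ∸1 r (suc k) _ = r≤r+2κ-1 r k

rhs : (r κ : ℕ) → 1 ≤ κ → ℚ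
rhs r κ 1≤κ = ((+ (2 ^ r * ((r + κ ∸ 1) C r))) ℚ./ ((r + 2 * κ ∸ 1) C r))
  {{C-nonZero (r + 2 * κ ∸ 1) r (r≤r+2κ∸1 r κ 1≤κ)}}

module Submission where

-- Write the l-th summand as C(r,2l)·a_l with a_l = ∏_{j<l} (2j+1)/(2κ+2j+1), and put
-- S_r = Σ_l C(r,2l)·a_l and T_r = Σ_l C(r,2l+1)·a_{l+1}; terms with 2l > r vanish, so any
-- upper limit beyond r/2 gives the same sums. Pascal's rule gives S_{r+1} = S_r + T_r. The
-- identity (k+1)·C(r,k+1) + k·C(r,k) = r·C(r,k) at k = 2l and k = 2l+1, together with
-- (2κ+2l+1)·a_{l+1} = (2l+1)·a_l, makes (2κ+r)·T_r − r·S_r telescope to 0. Hence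
-- (2κ+r)·S_{r+1} = 2(κ+r)·S_r, the recursion satisfied by 2^r·C(r+κ−1,r)/C(r+2κ−1,r),
-- and both sides equal 1 at r = 0.

open import Defs

module Binomial where

  open import Data.Nat using (ℕ; zero; suc; _+_; _*_; _∸_; _≤_; z≤n; s≤s)
  open import Data.Nat.Combinatorics using (_C_; nCk+nC[k+1]≡[n+1]C[k+1]; nC1≡n; k>n⇒nCk≡0)
  open import Data.Nat.Properties
    using (+-comm; +-identityʳ; *-identityʳ; *-zeroʳ; *-distribˡ-+; *-distribʳ-∸; m+n∸n≡m; ∸-+-assoc; m≤n⇒m<n∨m≡n
          ; *-commutativeSemigroup)
  open import Algebra.Properties.CommutativeSemigroup *-commutativeSemigroup
    using (x∙yz≈yx∙z; xy∙z≈x∙zy; x∙yz≈y∙xz)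
  open import Data.Nat.Tactic.RingSolver using (solve-∀)
  open import Data.Sum using (inj₁; inj₂)
  open import Relation.Binary.PropositionalEquality
  open ≡-Reasoning

  [k+1]*[n+1]C[k+1]≡[n+1]*nCk : ∀ n k → suc k * (suc n C suc k) ≡ suc n * (n C k)
  [k+1]*[n+1]C[k+1]≡[n+1]*nCk zero    zero    = refl
  [k+1]*[n+1]C[k+1]≡[n+1]*nCk zero    (suc k)
    rewrite k>n⇒nCk≡0 {1} {suc (suc k)} (s≤s (s≤s z≤n)) | k>n⇒nCk≡0 {0} {suc k} (s≤s z≤n)
    = *-zeroʳ (suc (suc k))
  [k+1]*[n+1]C[k+1]≡[n+1]*nCk (suc n) zero    =
    trans (+-identityʳ _) (trans (nC1≡n (suc (suc n))) (sym (*-identityʳ (suc (suc n)))))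
  [k+1]*[n+1]C[k+1]≡[n+1]*nCk (suc n) (suc k) = begin
    suc (suc k) * (suc (suc n) C suc (suc k))
      ≡⟨ cong (suc (suc k) *_) (nCk+nC[k+1]≡[n+1]C[k+1] (suc n) (suc k)) ⟨
    suc (suc k) * (a + b)
      ≡⟨ regroup k a b ⟩
    suc k * a + suc (suc k) * b + a
      ≡⟨ cong₂ (λ x y → x + y + a) ([k+1]*[n+1]C[k+1]≡[n+1]*nCk n k) ([k+1]*[n+1]C[k+1]≡[n+1]*nCk n (suc k)) ⟩
    suc n * (n C k) + suc n * (n C suc k) + a
      ≡⟨ cong (_+ a) (*-distribˡ-+ (suc n) (n C k) (n C suc k)) ⟨
    suc n * (n C k + n C suc k) + a
      ≡⟨ cong (λ x → suc n * x + a) (nCk+nC[k+1]≡[n+1]C[k+1] n k) ⟩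
    suc n * a + a
      ≡⟨ +-comm (suc n * a) a ⟩
    suc (suc n) * a ∎
    where
    a b : ℕ
    a = suc n C suc k
    b = suc n C suc (suc k)
    regroup : ∀ k a b → suc (suc k) * (a + b) ≡ suc k * a + suc (suc k) * b + a
    regroup = solve-∀

  [k+1]*nC[k+1]+k*nCk≡n*nCk : ∀ n k → suc k * (n C suc k) + k * (n C k) ≡ n * (n C k)
  [k+1]*nC[k+1]+k*nCk≡n*nCk n       zero    =
    trans (+-identityʳ _) (trans (+-identityʳ _) (trans (nC1≡n n) (sym (*-identityʳ n))))
  [k+1]*nC[k+1]+k*nCk≡n*nCk zero    (suc k)
    rewrite k>n⇒nCk≡0 {0} {suc (suc k)} (s≤s z≤n) | k>n⇒nCk≡0 {0} {suc k} (s≤s z≤n)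
          | *-zeroʳ (suc k) = refl
  [k+1]*nC[k+1]+k*nCk≡n*nCk (suc n) (suc k) = begin
    suc (suc k) * (suc n C suc (suc k)) + suc k * (suc n C suc k)
      ≡⟨ cong₂ _+_ ([k+1]*[n+1]C[k+1]≡[n+1]*nCk n (suc k)) ([k+1]*[n+1]C[k+1]≡[n+1]*nCk n k) ⟩
    suc n * (n C suc k) + suc n * (n C k)
      ≡⟨ *-distribˡ-+ (suc n) (n C suc k) (n C k) ⟨
    suc n * (n C suc k + n C k)
      ≡⟨ cong (suc n *_) (trans (+-comm (n C suc k) (n C k)) (nCk+nC[k+1]≡[n+1]C[k+1] n k)) ⟩
    suc n * (suc n C suc k) ∎

  [k+1]*nC[k+1]≡[n∸k]*nCk : ∀ n k → suc k * (n C suc k) ≡ (n ∸ k) * (n C k)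
  [k+1]*nC[k+1]≡[n∸k]*nCk n k = begin
    suc k * (n C suc k)                              ≡⟨ m+n∸n≡m _ (k * (n C k)) ⟨
    suc k * (n C suc k) + k * (n C k) ∸ k * (n C k)  ≡⟨ cong (_∸ k * (n C k)) ([k+1]*nC[k+1]+k*nCk≡n*nCk n k) ⟩
    n * (n C k) ∸ k * (n C k)                        ≡⟨ *-distribʳ-∸ (n C k) n k ⟨
    (n ∸ k) * (n C k)                                ∎

  nCk*[n∸k]*[n∸k∸1]≡[k+2]*[k+1]*nC[k+2] : ∀ n k → (n C k) * ((n ∸ k) * (n ∸ k ∸ 1)) ≡ suc (suc k) * (suc k * (n C suc (suc k)))
  nCk*[n∸k]*[n∸k∸1]≡[k+2]*[k+1]*nC[k+2] n k = begin
    (n C k) * ((n ∸ k) * (n ∸ k ∸ 1))          ≡⟨ x∙yz≈yx∙z (n C k) (n ∸ k) (n ∸ k ∸ 1) ⟩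
    (n ∸ k) * (n C k) * (n ∸ k ∸ 1)            ≡⟨ cong₂ _*_ ([k+1]*nC[k+1]≡[n∸k]*nCk n k) n∸[1+k]≡n∸k∸1 ⟨
    suc k * (n C suc k) * (n ∸ suc k)          ≡⟨ xy∙z≈x∙zy (suc k) (n C suc k) (n ∸ suc k) ⟩
    suc k * ((n ∸ suc k) * (n C suc k))        ≡⟨ cong (suc k *_) ([k+1]*nC[k+1]≡[n∸k]*nCk n (suc k)) ⟨
    suc k * (suc (suc k) * (n C suc (suc k)))  ≡⟨ x∙yz≈y∙xz (suc k) (suc (suc k)) (n C suc (suc k)) ⟩
    suc (suc k) * (suc k * (n C suc (suc k)))  ∎
    where
    n∸[1+k]≡n∸k∸1 : n ∸ suc k ≡ n ∸ k ∸ 1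
    n∸[1+k]≡n∸k∸1 = trans (cong (n ∸_) (+-comm 1 k)) (sym (∸-+-assoc n k 1))

  n≤k⇒k*nCk≡n*nCk : ∀ {n k} → n ≤ k → k * (n C k) ≡ n * (n C k)
  n≤k⇒k*nCk≡n*nCk {n} {k} n≤k with m≤n⇒m<n∨m≡n n≤k
  ... | inj₁ n<k rewrite k>n⇒nCk≡0 n<k | *-zeroʳ k | *-zeroʳ n = refl
  ... | inj₂ refl = refl

module Embedding where

  open import Data.Integer as ℤ using (+_)
  import Data.Integer.Properties as ℤ
  open import Data.Nat as ℕ using (suc; NonZero)
  import Data.Nat.Properties as ℕ
  open import Data.Rational using (ℚ; _+_; _*_; _/_; 1ℚ; fromℚᵘ)
  open import Data.Rational.Properties
    using (toℚᵘ-injective; toℚᵘ-fromℚᵘ; toℚᵘ-homo-+; toℚᵘ-homo-*; fromℚᵘ-cong; *-identityˡ; *-assoc; *-comm)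
  open import Data.Rational.Unnormalised as ℚᵘ using (*≡*)
  import Data.Rational.Unnormalised.Properties as ℚᵘ
  open import Relation.Binary.PropositionalEquality
  open ≡-Reasoning

  fromℚᵘ-homo-+ : ∀ p q → fromℚᵘ (p ℚᵘ.+ q) ≡ fromℚᵘ p + fromℚᵘ q
  fromℚᵘ-homo-+ p q = toℚᵘ-injective (ℚᵘ.≃-trans (toℚᵘ-fromℚᵘ (p ℚᵘ.+ q)) (ℚᵘ.≃-sym
    (ℚᵘ.≃-trans (toℚᵘ-homo-+ (fromℚᵘ p) (fromℚᵘ q)) (ℚᵘ.+-cong (toℚᵘ-fromℚᵘ p) (toℚᵘ-fromℚᵘ q)))))

  fromℚᵘ-homo-* : ∀ p q → fromℚᵘ (p ℚᵘ.* q) ≡ fromℚᵘ p * fromℚᵘ q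
  fromℚᵘ-homo-* p q = toℚᵘ-injective (ℚᵘ.≃-trans (toℚᵘ-fromℚᵘ (p ℚᵘ.* q)) (ℚᵘ.≃-sym
    (ℚᵘ.≃-trans (toℚᵘ-homo-* (fromℚᵘ p) (fromℚᵘ q)) (ℚᵘ.*-cong (toℚᵘ-fromℚᵘ p) (toℚᵘ-fromℚᵘ q)))))

  -- ⟦ n ⟧ is definitionally fromℚᵘ (+ n ℚᵘ./ 1), and (+ n) / suc d is fromℚᵘ (+ n ℚᵘ./ suc d).

  ⟦⟧-homo-+ : ∀ m n → ⟦ m ℕ.+ n ⟧ ≡ ⟦ m ⟧ + ⟦ n ⟧
  ⟦⟧-homo-+ m n = trans
    (fromℚᵘ-cong {+ (m ℕ.+ n) ℚᵘ./ 1} {+ m ℚᵘ./ 1 ℚᵘ.+ + n ℚᵘ./ 1} (*≡* (cong (ℤ._* + 1)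
      (trans (ℤ.pos-+ m n) (sym (cong₂ ℤ._+_ (ℤ.*-identityʳ (+ m)) (ℤ.*-identityʳ (+ n))))))))
    (fromℚᵘ-homo-+ (+ m ℚᵘ./ 1) (+ n ℚᵘ./ 1))

  ⟦⟧-homo-* : ∀ m n → ⟦ m ℕ.* n ⟧ ≡ ⟦ m ⟧ * ⟦ n ⟧
  ⟦⟧-homo-* m n = trans
    (fromℚᵘ-cong {+ (m ℕ.* n) ℚᵘ./ 1} {(+ m ℚᵘ./ 1) ℚᵘ.* (+ n ℚᵘ./ 1)} (*≡* (cong (ℤ._* + 1) (ℤ.pos-* m n))))
    (fromℚᵘ-homo-* (+ m ℚᵘ./ 1) (+ n ℚᵘ./ 1))

  ⟦⟧-*-/ : ∀ m n d → ⟦ m ⟧ * ((+ n) / suc d) ≡ (+ (m ℕ.* n)) / suc d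
  ⟦⟧-*-/ m n d = trans (sym (fromℚᵘ-homo-* (+ m ℚᵘ./ 1) (+ n ℚᵘ./ suc d)))
    (fromℚᵘ-cong {(+ m ℚᵘ./ 1) ℚᵘ.* (+ n ℚᵘ./ suc d)} {+ (m ℕ.* n) ℚᵘ./ suc d}
      (*≡* (cong₂ ℤ._*_ (sym (ℤ.pos-* m n)) (cong +_ (sym (ℕ.+-identityʳ (suc d)))))))

  *-cancelˡ-/ : ∀ k n d → (+ (suc k ℕ.* n)) / (suc k ℕ.* suc d) ≡ (+ n) / suc d
  *-cancelˡ-/ k n d = trans (cong (λ i → i / (suc k ℕ.* suc d)) (ℤ.pos-* (suc k) n))
    (fromℚᵘ-cong (ℚᵘ.*-cancelˡ-/ (suc k) {+ n} {suc d}))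

  ⟦d⟧*[n/d]≡⟦n⟧ : ∀ d n → ⟦ suc d ⟧ * ((+ n) / suc d) ≡ ⟦ n ⟧
  ⟦d⟧*[n/d]≡⟦n⟧ d n = trans (⟦⟧-*-/ (suc d) n d)
    (fromℚᵘ-cong {+ (suc d ℕ.* n) ℚᵘ./ suc d} {+ n ℚᵘ./ 1}
      (*≡* (trans (ℤ.*-identityʳ _) (trans (ℤ.pos-* (suc d) n) (ℤ.*-comm (+ suc d) (+ n))))))

  ⟦⟧-cancelˡ : ∀ d .{{_ : NonZero d}} {x y} → ⟦ d ⟧ * x ≡ ⟦ d ⟧ * y → x ≡ y
  ⟦⟧-cancelˡ (suc d) {x} {y} eq = trans (sym (undo x)) (trans (cong (reciprocal *_) eq) (undo y))
    where
    reciprocal : ℚ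
    reciprocal = (+ 1) / suc d
    undo : ∀ z → reciprocal * (⟦ suc d ⟧ * z) ≡ z
    undo z = begin
      reciprocal * (⟦ suc d ⟧ * z) ≡⟨ *-assoc reciprocal ⟦ suc d ⟧ z ⟨
      reciprocal * ⟦ suc d ⟧ * z   ≡⟨ cong (_* z) (trans (*-comm reciprocal ⟦ suc d ⟧) (⟦d⟧*[n/d]≡⟦n⟧ d 1)) ⟩
      1ℚ * z                       ≡⟨ *-identityˡ z ⟩
      z                            ∎

  ⟦d⟧*x≡⟦a⟧⇒x≡a/d : ∀ a d .{{_ : NonZero d}} {x} → ⟦ d ⟧ * x ≡ ⟦ a ⟧ → x ≡ (+ a) / d
  ⟦d⟧*x≡⟦a⟧⇒x≡a/d a (suc d) eq = ⟦⟧-cancelˡ (suc d) (trans eq (sym (⟦d⟧*[n/d]≡⟦n⟧ d a)))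

module Sums where

  open import Algebra.Bundles using (CommutativeMonoid)
  open import Algebra.Core using (Op₂)
  open import Algebra.Definitions using (Associative; Identity)
  open import Data.List using (foldr; map; upTo; _∷ʳ_)
  open import Data.List.Properties using (foldr-∷ʳ; foldr-fusion; map-++; map-cong; upTo-∷ʳ; map-upTo; map-applyUpTo)
  open import Data.Nat using (ℕ; zero; suc)
  open import Data.Product using (proj₁; proj₂)
  open import Data.Rational using (ℚ; _+_; _*_; 0ℚ; 1ℚ)
  open import Data.Rational.Properties
    using (+-assoc; +-comm; +-identity; +-identityʳ; *-assoc; *-identity; *-distribˡ-+; *-zeroʳ; +-0-commutativeMonoid)
  open import Algebra.Properties.CommutativeSemigroup (CommutativeMonoid.commutativeSemigroup +-0-commutativeMonoid)
    using (interchange; xy∙z≈xz∙y)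
  open import Function using (_∘_)
  open import Relation.Binary.PropositionalEquality
  open ≡-Reasoning

  module _ {A : Set} (_∙_ : Op₂ A) (ε : A) (assoc : Associative _≡_ _∙_) (identity : Identity _≡_ ε _∙_) where

    foldr-∷ʳ-monoid : ∀ xs x → foldr _∙_ ε (xs ∷ʳ x) ≡ foldr _∙_ ε xs ∙ x
    foldr-∷ʳ-monoid xs x = begin
      foldr _∙_ ε (xs ∷ʳ x)  ≡⟨ foldr-∷ʳ _∙_ ε x xs ⟩
      foldr _∙_ (x ∙ ε) xs   ≡⟨ cong (λ e → foldr _∙_ e xs) (trans (proj₂ identity x) (sym (proj₁ identity x))) ⟩
      foldr _∙_ (ε ∙ x) xs   ≡⟨ foldr-fusion (_∙ x) ε (λ y z → assoc y z x) xs ⟨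
      foldr _∙_ ε xs ∙ x     ∎

    foldr-map-upTo-suc : ∀ n (f : ℕ → A) →
      foldr _∙_ ε (map f (upTo (suc n))) ≡ foldr _∙_ ε (map f (upTo n)) ∙ f n
    foldr-map-upTo-suc n f = begin
      foldr _∙_ ε (map f (upTo (suc n)))    ≡⟨ cong (foldr _∙_ ε ∘ map f) (upTo-∷ʳ n) ⟨
      foldr _∙_ ε (map f (upTo n ∷ʳ n))     ≡⟨ cong (foldr _∙_ ε) (map-++ f (upTo n) _) ⟩
      foldr _∙_ ε (map f (upTo n) ∷ʳ f n)   ≡⟨ foldr-∷ʳ-monoid (map f (upTo n)) (f n) ⟩
      foldr _∙_ ε (map f (upTo n)) ∙ f n    ∎

  Σℚ-suc : ∀ n f → Σℚ (suc n) f ≡ Σℚ n f + f n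
  Σℚ-suc = foldr-map-upTo-suc _+_ 0ℚ +-assoc +-identity

  Πℚ-suc : ∀ n f → Πℚ (suc n) f ≡ Πℚ n f * f n
  Πℚ-suc = foldr-map-upTo-suc _*_ 1ℚ *-assoc *-identity

  Σℚ-shift : ∀ n f → Σℚ (suc n) f ≡ f 0 + Σℚ n (f ∘ suc)
  Σℚ-shift n f = cong (λ xs → f 0 + foldr _+_ 0ℚ xs)
    (trans (map-applyUpTo suc f n) (sym (map-upTo (f ∘ suc) n)))

  Σℚ-cong : ∀ n {f g} → (∀ i → f i ≡ g i) → Σℚ n f ≡ Σℚ n g
  Σℚ-cong n f≗g = cong (foldr _+_ 0ℚ) (map-cong f≗g (upTo n))

  Σℚ-zero : ∀ n → Σℚ n (λ _ → 0ℚ) ≡ 0ℚ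
  Σℚ-zero zero    = refl
  Σℚ-zero (suc n) = trans (Σℚ-suc n _) (trans (+-identityʳ _) (Σℚ-zero n))

  Σℚ-+ : ∀ n f g → Σℚ n (λ i → f i + g i) ≡ Σℚ n f + Σℚ n g
  Σℚ-+ zero    f g = refl
  Σℚ-+ (suc n) f g = begin
    Σℚ (suc n) (λ i → f i + g i)          ≡⟨ Σℚ-suc n _ ⟩
    Σℚ n (λ i → f i + g i) + (f n + g n)  ≡⟨ cong (_+ (f n + g n)) (Σℚ-+ n f g) ⟩
    Σℚ n f + Σℚ n g + (f n + g n)         ≡⟨ interchange (Σℚ n f) (Σℚ n g) (f n) (g n) ⟩
    (Σℚ n f + f n) + (Σℚ n g + g n)       ≡⟨ cong₂ _+_ (Σℚ-suc n f) (Σℚ-suc n g) ⟨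
    Σℚ (suc n) f + Σℚ (suc n) g           ∎

  Σℚ-*ˡ : ∀ c n f → c * Σℚ n f ≡ Σℚ n (λ i → c * f i)
  Σℚ-*ˡ c zero    f = *-zeroʳ c
  Σℚ-*ˡ c (suc n) f = begin
    c * Σℚ (suc n) f                  ≡⟨ cong (c *_) (Σℚ-suc n f) ⟩
    c * (Σℚ n f + f n)                ≡⟨ *-distribˡ-+ c (Σℚ n f) (f n) ⟩
    c * Σℚ n f + c * f n              ≡⟨ cong (_+ c * f n) (Σℚ-*ˡ c n f) ⟩
    Σℚ n (λ i → c * f i) + c * f n    ≡⟨ Σℚ-suc n _ ⟨
    Σℚ (suc n) (λ i → c * f i)        ∎

  Σℚ-telescope : ∀ n (f g h : ℕ → ℚ) → (∀ i → f i + g i ≡ h i + g (suc i)) → Σℚ n f + g 0 ≡ Σℚ n h + g n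
  Σℚ-telescope zero    f g h step = refl
  Σℚ-telescope (suc n) f g h step = begin
    Σℚ (suc n) f + g 0         ≡⟨ cong (_+ g 0) (Σℚ-suc n f) ⟩
    Σℚ n f + f n + g 0         ≡⟨ xy∙z≈xz∙y (Σℚ n f) (f n) (g 0) ⟩
    Σℚ n f + g 0 + f n         ≡⟨ cong (_+ f n) (Σℚ-telescope n f g h step) ⟩
    Σℚ n h + g n + f n         ≡⟨ +-assoc (Σℚ n h) (g n) (f n) ⟩
    Σℚ n h + (g n + f n)       ≡⟨ cong (Σℚ n h +_) (trans (+-comm (g n) (f n)) (step n)) ⟩
    Σℚ n h + (h n + g (suc n)) ≡⟨ +-assoc (Σℚ n h) (h n) (g (suc n)) ⟨
    Σℚ n h + h n + g (suc n)   ≡⟨ cong (_+ g (suc n)) (Σℚ-suc n h) ⟨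
    Σℚ (suc n) h + g (suc n)   ∎

module EvenSums where

  open Binomial
  open Embedding
  open Sums
  open import Algebra.Bundles using (CommutativeMonoid)
  import Algebra.Properties.CommutativeSemigroup as CommSemigroupProperties
  open import Data.Integer using (+_)
  open import Data.List using (_∷_; [])
  open import Data.Maybe using (nothing)
  open import Data.Nat as ℕ using (ℕ; zero; suc; _∸_; _≤_; _<_; z≤n; s≤s; _^_)
  import Data.Nat.Properties as ℕ
  open import Data.Nat.Combinatorics using (_C_; nCk+nC[k+1]≡[n+1]C[k+1]; k>n⇒nCk≡0)
  open import Data.Rational using (ℚ; _+_; _*_; _/_; 0ℚ; 1ℚ)
  open import Data.Rational.Properties
    using (+-identityʳ; *-identityˡ; *-zeroˡ; *-comm; *-assoc; *-distribˡ-+; *-distribʳ-+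
          ; +-0-commutativeMonoid; *-1-commutativeMonoid; +-*-commutativeRing)
  open import Function using (_∘_)
  open import Level using (0ℓ)
  open import Relation.Binary.PropositionalEquality
  open import Data.Nat.Tactic.RingSolver using (solve-∀)
  open import Tactic.RingSolver using (solve)
  open import Tactic.RingSolver.Core.AlmostCommutativeRing using (AlmostCommutativeRing; fromCommutativeRing)
  open ≡-Reasoning

  private
    module +-Props = CommSemigroupProperties (CommutativeMonoid.commutativeSemigroup +-0-commutativeMonoid)
    module *-Props = CommSemigroupProperties (CommutativeMonoid.commutativeSemigroup *-1-commutativeMonoid)

    ℚ-ring : AlmostCommutativeRing 0ℓ 0ℓ
    ℚ-ring = fromCommutativeRing +-*-commutativeRing (λ _ → nothing)

  nCk-two-step-ratio : ∀ n k d → ⟦ n C k ⟧ * ((+ ((n ∸ k) ℕ.* (n ∸ k ∸ 1))) / (suc (k ℕ.+ 1) ℕ.* suc d))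
                    ≡ ⟦ n C suc (suc k) ⟧ * ((+ suc k) / suc d)
  nCk-two-step-ratio n k d rewrite ℕ.+-comm k 1 = begin
    ⟦ n C k ⟧ * ((+ ((n ∸ k) ℕ.* (n ∸ k ∸ 1))) / (suc (suc k) ℕ.* suc d))
      ≡⟨ ⟦⟧-*-/ (n C k) ((n ∸ k) ℕ.* (n ∸ k ∸ 1)) _ ⟩
    (+ ((n C k) ℕ.* ((n ∸ k) ℕ.* (n ∸ k ∸ 1)))) / (suc (suc k) ℕ.* suc d)
      ≡⟨ cong (λ m → (+ m) / (suc (suc k) ℕ.* suc d)) (nCk*[n∸k]*[n∸k∸1]≡[k+2]*[k+1]*nC[k+2] n k) ⟩
    (+ (suc (suc k) ℕ.* (suc k ℕ.* (n C suc (suc k))))) / (suc (suc k) ℕ.* suc d)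
      ≡⟨ *-cancelˡ-/ (suc k) (suc k ℕ.* (n C suc (suc k))) d ⟩
    (+ (suc k ℕ.* (n C suc (suc k)))) / suc d
      ≡⟨ cong (λ m → (+ m) / suc d) (ℕ.*-comm (suc k) (n C suc (suc k))) ⟩
    (+ ((n C suc (suc k)) ℕ.* suc k)) / suc d
      ≡⟨ ⟦⟧-*-/ (n C suc (suc k)) (suc k) d ⟨
    ⟦ n C suc (suc k) ⟧ * ((+ suc k) / suc d) ∎

  oddRatio : ℕ → ℕ → ℚ
  oddRatio κ zero    = 1ℚ
  oddRatio κ (suc l) = oddRatio κ l * ((+ suc (2 ℕ.* l)) / suc (2 ℕ.* κ ℕ.+ 2 ℕ.* l))

  oddRatio-suc : ∀ κ l → ⟦ 2 ℕ.* κ ℕ.+ suc (2 ℕ.* l) ⟧ * oddRatio κ (suc l) ≡ ⟦ suc (2 ℕ.* l) ⟧ * oddRatio κ l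
  oddRatio-suc κ l = begin
    ⟦ 2 ℕ.* κ ℕ.+ suc (2 ℕ.* l) ⟧ * (oddRatio κ l * q)
      ≡⟨ cong (λ m → ⟦ m ⟧ * (oddRatio κ l * q)) (ℕ.+-suc (2 ℕ.* κ) (2 ℕ.* l)) ⟩
    ⟦ suc (2 ℕ.* κ ℕ.+ 2 ℕ.* l) ⟧ * (oddRatio κ l * q)
      ≡⟨ *-Props.x∙yz≈y∙xz ⟦ suc (2 ℕ.* κ ℕ.+ 2 ℕ.* l) ⟧ (oddRatio κ l) q ⟩
    oddRatio κ l * (⟦ suc (2 ℕ.* κ ℕ.+ 2 ℕ.* l) ⟧ * q)
      ≡⟨ cong (oddRatio κ l *_) (⟦d⟧*[n/d]≡⟦n⟧ (2 ℕ.* κ ℕ.+ 2 ℕ.* l) (suc (2 ℕ.* l))) ⟩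
    oddRatio κ l * ⟦ suc (2 ℕ.* l) ⟧
      ≡⟨ *-comm (oddRatio κ l) ⟦ suc (2 ℕ.* l) ⟧ ⟩
    ⟦ suc (2 ℕ.* l) ⟧ * oddRatio κ l ∎
    where
    q : ℚ
    q = (+ suc (2 ℕ.* l)) / suc (2 ℕ.* κ ℕ.+ 2 ℕ.* l)

  term≡C*oddRatio : ∀ r κ l → term r κ l ≡ ⟦ r C (2 ℕ.* l) ⟧ * oddRatio κ l
  term≡C*oddRatio r κ zero    = refl
  term≡C*oddRatio r κ (suc l) = begin
    term r κ (suc l)
      ≡⟨ Πℚ-suc l factor ⟩
    term r κ l * factor l
      ≡⟨ cong (_* factor l) (term≡C*oddRatio r κ l) ⟩
    ⟦ r C (2 ℕ.* l) ⟧ * oddRatio κ l * factor l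
      ≡⟨ *-Props.xy∙z≈y∙xz ⟦ r C (2 ℕ.* l) ⟧ (oddRatio κ l) (factor l) ⟩
    oddRatio κ l * (⟦ r C (2 ℕ.* l) ⟧ * factor l)
      ≡⟨ cong (oddRatio κ l *_) (nCk-two-step-ratio r (2 ℕ.* l) (2 ℕ.* κ ℕ.+ 2 ℕ.* l)) ⟩
    oddRatio κ l * (⟦ r C suc (suc (2 ℕ.* l)) ⟧ * q)
      ≡⟨ *-Props.x∙yz≈y∙xz (oddRatio κ l) ⟦ r C suc (suc (2 ℕ.* l)) ⟧ q ⟩
    ⟦ r C suc (suc (2 ℕ.* l)) ⟧ * oddRatio κ (suc l)
      ≡⟨ cong (λ k → ⟦ r C k ⟧ * oddRatio κ (suc l)) (ℕ.*-suc 2 l) ⟨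
    ⟦ r C (2 ℕ.* suc l) ⟧ * oddRatio κ (suc l) ∎
    where
    factor : ℕ → ℚ
    factor j = (+ ((r ∸ 2 ℕ.* j) ℕ.* (r ∸ 2 ℕ.* j ∸ 1))) / (suc (2 ℕ.* j ℕ.+ 1) ℕ.* suc (2 ℕ.* κ ℕ.+ 2 ℕ.* j))
    q : ℚ
    q = (+ suc (2 ℕ.* l)) / suc (2 ℕ.* κ ℕ.+ 2 ℕ.* l)

  -- Used with K = 2κ, R = r, o = 2l+1, e = 2l, e₂ = 2l+2, cᵢ = C(r,2l+i), a = a_l, a′ = a_{l+1}.
  telescoping-step : ∀ K R o e e₂ c₀ c₁ c₂ a a′ →
    (K + o) * a′ ≡ o * a →
    o * c₁ + e * c₀ ≡ R * c₀ →
    e₂ * c₂ + o * c₁ ≡ R * c₁ →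
    (K + R) * (c₁ * a′) + e * (c₀ * a) ≡ R * (c₀ * a) + e₂ * (c₂ * a′)
  telescoping-step K R o e e₂ c₀ c₁ c₂ a a′ ratio rising₀ rising₁ = begin
    (K + R) * (c₁ * a′) + e * (c₀ * a)
      ≡⟨ solve (K ∷ R ∷ e ∷ c₀ ∷ c₁ ∷ a ∷ a′ ∷ []) ℚ-ring ⟩
    K * (c₁ * a′) + (R * c₁) * a′ + e * (c₀ * a)
      ≡⟨ cong (λ x → K * (c₁ * a′) + x * a′ + e * (c₀ * a)) rising₁ ⟨
    K * (c₁ * a′) + (e₂ * c₂ + o * c₁) * a′ + e * (c₀ * a)
      ≡⟨ solve (K ∷ o ∷ e ∷ e₂ ∷ c₀ ∷ c₁ ∷ c₂ ∷ a ∷ a′ ∷ []) ℚ-ring ⟩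
    c₁ * ((K + o) * a′) + e₂ * (c₂ * a′) + e * (c₀ * a)
      ≡⟨ cong (λ x → c₁ * x + e₂ * (c₂ * a′) + e * (c₀ * a)) ratio ⟩
    c₁ * (o * a) + e₂ * (c₂ * a′) + e * (c₀ * a)
      ≡⟨ solve (o ∷ e ∷ e₂ ∷ c₀ ∷ c₁ ∷ c₂ ∷ a ∷ a′ ∷ []) ℚ-ring ⟩
    (o * c₁ + e * c₀) * a + e₂ * (c₂ * a′)
      ≡⟨ cong (λ x → x * a + e₂ * (c₂ * a′)) rising₀ ⟩
    (R * c₀) * a + e₂ * (c₂ * a′)
      ≡⟨ cong (_+ e₂ * (c₂ * a′)) (*-assoc R c₀ a) ⟩
    R * (c₀ * a) + e₂ * (c₂ * a′) ∎

  module _ (κ : ℕ) where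

    evenTerm oddTerm : ℕ → ℕ → ℚ
    evenTerm r l = ⟦ r C (2 ℕ.* l) ⟧ * oddRatio κ l
    oddTerm  r l = ⟦ r C suc (2 ℕ.* l) ⟧ * oddRatio κ (suc l)

    evenSum oddSum : ℕ → ℕ → ℚ
    evenSum r N = Σℚ N (evenTerm r)
    oddSum  r N = Σℚ N (oddTerm r)

    evenTerm-pascal : ∀ r l → evenTerm (suc r) (suc l) ≡ oddTerm r l + evenTerm r (suc l)
    evenTerm-pascal r l = begin
      ⟦ suc r C (2 ℕ.* suc l) ⟧ * a′
        ≡⟨ cong (λ k → ⟦ suc r C k ⟧ * a′) (ℕ.*-suc 2 l) ⟩
      ⟦ suc r C suc (suc (2 ℕ.* l)) ⟧ * a′
        ≡⟨ cong (λ m → ⟦ m ⟧ * a′) (nCk+nC[k+1]≡[n+1]C[k+1] r (suc (2 ℕ.* l))) ⟨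
      ⟦ r C suc (2 ℕ.* l) ℕ.+ r C suc (suc (2 ℕ.* l)) ⟧ * a′
        ≡⟨ cong (_* a′) (⟦⟧-homo-+ (r C suc (2 ℕ.* l)) (r C suc (suc (2 ℕ.* l)))) ⟩
      (⟦ r C suc (2 ℕ.* l) ⟧ + ⟦ r C suc (suc (2 ℕ.* l)) ⟧) * a′
        ≡⟨ *-distribʳ-+ a′ ⟦ r C suc (2 ℕ.* l) ⟧ ⟦ r C suc (suc (2 ℕ.* l)) ⟧ ⟩
      oddTerm r l + ⟦ r C suc (suc (2 ℕ.* l)) ⟧ * a′
        ≡⟨ cong (λ k → oddTerm r l + ⟦ r C k ⟧ * a′) (ℕ.*-suc 2 l) ⟨
      oddTerm r l + evenTerm r (suc l) ∎
      where
      a′ : ℚ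
      a′ = oddRatio κ (suc l)

    evenSum-pascal : ∀ r N → evenSum (suc r) (suc N) ≡ evenSum r (suc N) + oddSum r N
    evenSum-pascal r N = begin
      evenSum (suc r) (suc N)
        ≡⟨ Σℚ-shift N (evenTerm (suc r)) ⟩
      evenTerm r 0 + Σℚ N (evenTerm (suc r) ∘ suc)
        ≡⟨ cong (λ s → evenTerm r 0 + s) (trans (Σℚ-cong N (evenTerm-pascal r)) (Σℚ-+ N (oddTerm r) (evenTerm r ∘ suc))) ⟩
      evenTerm r 0 + (oddSum r N + Σℚ N (evenTerm r ∘ suc))
        ≡⟨ +-Props.x∙yz≈xz∙y (evenTerm r 0) (oddSum r N) (Σℚ N (evenTerm r ∘ suc)) ⟩
      evenTerm r 0 + Σℚ N (evenTerm r ∘ suc) + oddSum r N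
        ≡⟨ cong (_+ oddSum r N) (Σℚ-shift N (evenTerm r)) ⟨
      evenSum r (suc N) + oddSum r N ∎

    oddTerm-telescopes : ∀ r l → ⟦ 2 ℕ.* κ ℕ.+ r ⟧ * oddTerm r l + ⟦ 2 ℕ.* l ⟧ * evenTerm r l
                               ≡ ⟦ r ⟧ * evenTerm r l + ⟦ 2 ℕ.* suc l ⟧ * evenTerm r (suc l)
    oddTerm-telescopes r l = begin
      ⟦ 2 ℕ.* κ ℕ.+ r ⟧ * oddTerm r l + e * evenTerm r l
        ≡⟨ cong (λ x → x * oddTerm r l + e * evenTerm r l) (⟦⟧-homo-+ (2 ℕ.* κ) r) ⟩
      (⟦ 2 ℕ.* κ ⟧ + ⟦ r ⟧) * oddTerm r l + e * evenTerm r l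
        ≡⟨ telescoping-step ⟦ 2 ℕ.* κ ⟧ ⟦ r ⟧ ⟦ suc (2 ℕ.* l) ⟧ e ⟦ suc (suc (2 ℕ.* l)) ⟧
             ⟦ r C (2 ℕ.* l) ⟧ ⟦ r C suc (2 ℕ.* l) ⟧ ⟦ r C suc (suc (2 ℕ.* l)) ⟧ (oddRatio κ l) a′
             ratio (rising r (2 ℕ.* l)) (rising r (suc (2 ℕ.* l))) ⟩
      ⟦ r ⟧ * evenTerm r l + ⟦ suc (suc (2 ℕ.* l)) ⟧ * (⟦ r C suc (suc (2 ℕ.* l)) ⟧ * a′)
        ≡⟨ cong (λ k → ⟦ r ⟧ * evenTerm r l + ⟦ k ⟧ * (⟦ r C k ⟧ * a′)) (ℕ.*-suc 2 l) ⟨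
      ⟦ r ⟧ * evenTerm r l + ⟦ 2 ℕ.* suc l ⟧ * evenTerm r (suc l) ∎
      where
      e a′ : ℚ
      e = ⟦ 2 ℕ.* l ⟧
      a′ = oddRatio κ (suc l)
      ratio : (⟦ 2 ℕ.* κ ⟧ + ⟦ suc (2 ℕ.* l) ⟧) * a′ ≡ ⟦ suc (2 ℕ.* l) ⟧ * oddRatio κ l
      ratio = trans (cong (_* a′) (sym (⟦⟧-homo-+ (2 ℕ.* κ) (suc (2 ℕ.* l))))) (oddRatio-suc κ l)
      rising : ∀ n k → ⟦ suc k ⟧ * ⟦ n C suc k ⟧ + ⟦ k ⟧ * ⟦ n C k ⟧ ≡ ⟦ n ⟧ * ⟦ n C k ⟧
      rising n k = begin
        ⟦ suc k ⟧ * ⟦ n C suc k ⟧ + ⟦ k ⟧ * ⟦ n C k ⟧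
          ≡⟨ cong₂ _+_ (⟦⟧-homo-* (suc k) (n C suc k)) (⟦⟧-homo-* k (n C k)) ⟨
        ⟦ suc k ℕ.* (n C suc k) ⟧ + ⟦ k ℕ.* (n C k) ⟧
          ≡⟨ ⟦⟧-homo-+ (suc k ℕ.* (n C suc k)) (k ℕ.* (n C k)) ⟨
        ⟦ suc k ℕ.* (n C suc k) ℕ.+ k ℕ.* (n C k) ⟧
          ≡⟨ cong ⟦_⟧ ([k+1]*nC[k+1]+k*nCk≡n*nCk n k) ⟩
        ⟦ n ℕ.* (n C k) ⟧
          ≡⟨ ⟦⟧-homo-* n (n C k) ⟩
        ⟦ n ⟧ * ⟦ n C k ⟧ ∎

    oddSum-telescope : ∀ r N → ⟦ 2 ℕ.* κ ℕ.+ r ⟧ * oddSum r N ≡ ⟦ r ⟧ * evenSum r N + ⟦ 2 ℕ.* N ⟧ * evenTerm r N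
    oddSum-telescope r N = begin
      X * oddSum r N
        ≡⟨ Σℚ-*ˡ X N (oddTerm r) ⟩
      Σℚ N (λ l → X * oddTerm r l)
        ≡⟨ +-identityʳ _ ⟨
      Σℚ N (λ l → X * oddTerm r l) + 0ℚ
        ≡⟨ Σℚ-telescope N _ (λ l → ⟦ 2 ℕ.* l ⟧ * evenTerm r l) _ (oddTerm-telescopes r) ⟩
      Σℚ N (λ l → ⟦ r ⟧ * evenTerm r l) + ⟦ 2 ℕ.* N ⟧ * evenTerm r N
        ≡⟨ cong (_+ ⟦ 2 ℕ.* N ⟧ * evenTerm r N) (Σℚ-*ˡ ⟦ r ⟧ N (evenTerm r)) ⟨
      ⟦ r ⟧ * evenSum r N + ⟦ 2 ℕ.* N ⟧ * evenTerm r N ∎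
      where
      X : ℚ
      X = ⟦ 2 ℕ.* κ ℕ.+ r ⟧

    oddSum≡evenSum : ∀ {r N} → r ≤ 2 ℕ.* N → ⟦ 2 ℕ.* κ ℕ.+ r ⟧ * oddSum r N ≡ ⟦ r ⟧ * evenSum r (suc N)
    oddSum≡evenSum {r} {N} r≤2N = begin
      ⟦ 2 ℕ.* κ ℕ.+ r ⟧ * oddSum r N
        ≡⟨ oddSum-telescope r N ⟩
      ⟦ r ⟧ * evenSum r N + ⟦ 2 ℕ.* N ⟧ * evenTerm r N
        ≡⟨ cong (λ x → ⟦ r ⟧ * evenSum r N + x) (boundary r≤2N (oddRatio κ N)) ⟩
      ⟦ r ⟧ * evenSum r N + ⟦ r ⟧ * evenTerm r N
        ≡⟨ *-distribˡ-+ ⟦ r ⟧ (evenSum r N) (evenTerm r N) ⟨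
      ⟦ r ⟧ * (evenSum r N + evenTerm r N)
        ≡⟨ cong (⟦ r ⟧ *_) (Σℚ-suc N (evenTerm r)) ⟨
      ⟦ r ⟧ * evenSum r (suc N) ∎
      where
      boundary : ∀ {n k} → n ≤ k → ∀ x → ⟦ k ⟧ * (⟦ n C k ⟧ * x) ≡ ⟦ n ⟧ * (⟦ n C k ⟧ * x)
      boundary {n} {k} n≤k x = begin
        ⟦ k ⟧ * (⟦ n C k ⟧ * x)     ≡⟨ *-assoc ⟦ k ⟧ ⟦ n C k ⟧ x ⟨
        ⟦ k ⟧ * ⟦ n C k ⟧ * x       ≡⟨ cong (_* x) (⟦⟧-homo-* k (n C k)) ⟨
        ⟦ k ℕ.* (n C k) ⟧ * x       ≡⟨ cong (λ m → ⟦ m ⟧ * x) (n≤k⇒k*nCk≡n*nCk n≤k) ⟩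
        ⟦ n ℕ.* (n C k) ⟧ * x       ≡⟨ cong (_* x) (⟦⟧-homo-* n (n C k)) ⟩
        ⟦ n ⟧ * ⟦ n C k ⟧ * x       ≡⟨ *-assoc ⟦ n ⟧ ⟦ n C k ⟧ x ⟩
        ⟦ n ⟧ * (⟦ n C k ⟧ * x)     ∎

    evenSum-ratio : ∀ {r N} → suc r < 2 ℕ.* N →
                    ⟦ 2 ℕ.* κ ℕ.+ r ⟧ * evenSum (suc r) N ≡ ⟦ 2 ℕ.* κ ℕ.+ r ℕ.+ r ⟧ * evenSum r N
    evenSum-ratio {r} {suc N} 1+r<2N = begin
      X * evenSum (suc r) (suc N)
        ≡⟨ cong (X *_) (evenSum-pascal r N) ⟩
      X * (evenSum r (suc N) + oddSum r N)
        ≡⟨ *-distribˡ-+ X (evenSum r (suc N)) (oddSum r N) ⟩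
      X * evenSum r (suc N) + X * oddSum r N
        ≡⟨ cong (λ x → X * evenSum r (suc N) + x) (oddSum≡evenSum {r} {N} r≤2N) ⟩
      X * evenSum r (suc N) + ⟦ r ⟧ * evenSum r (suc N)
        ≡⟨ *-distribʳ-+ (evenSum r (suc N)) X ⟦ r ⟧ ⟨
      (X + ⟦ r ⟧) * evenSum r (suc N)
        ≡⟨ cong (_* evenSum r (suc N)) (⟦⟧-homo-+ (2 ℕ.* κ ℕ.+ r) r) ⟨
      ⟦ 2 ℕ.* κ ℕ.+ r ℕ.+ r ⟧ * evenSum r (suc N) ∎
      where
      X : ℚ
      X = ⟦ 2 ℕ.* κ ℕ.+ r ⟧
      r≤2N : r ≤ 2 ℕ.* N
      r≤2N = ℕ.≤-pred (ℕ.≤-pred (subst (suc (suc r) ≤_) (ℕ.*-suc 2 N) 1+r<2N))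

    evenSum-zero : ∀ N → evenSum 0 (suc N) ≡ 1ℚ
    evenSum-zero N = begin
      evenSum 0 (suc N)                   ≡⟨ Σℚ-shift N (evenTerm 0) ⟩
      1ℚ + Σℚ N (evenTerm 0 ∘ suc)        ≡⟨ cong (λ x → 1ℚ + x) (trans (Σℚ-cong N vanish) (Σℚ-zero N)) ⟩
      1ℚ + 0ℚ                             ≡⟨ +-identityʳ 1ℚ ⟩
      1ℚ                                  ∎
      where
      vanish : ∀ l → evenTerm 0 (suc l) ≡ 0ℚ
      vanish l = trans (cong (λ c → ⟦ c ⟧ * oddRatio κ (suc l)) (k>n⇒nCk≡0 {k = 2 ℕ.* suc l} (s≤s z≤n))) (*-zeroˡ (oddRatio κ (suc l)))

  closedForm-step : ∀ K r →
    suc (r ℕ.+ suc (2 ℕ.* K)) ℕ.* (2 ℕ.* suc K ℕ.+ r ℕ.+ r) ℕ.* (2 ^ r ℕ.* ((r ℕ.+ K) C r))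
      ≡ suc r ℕ.* (2 ℕ.* suc K ℕ.+ r) ℕ.* (2 ^ suc r ℕ.* ((suc r ℕ.+ K) C suc r))
  closedForm-step K r = begin
    suc (r ℕ.+ suc (2 ℕ.* K)) ℕ.* (X ℕ.+ r) ℕ.* (2 ^ r ℕ.* E)  ≡⟨ expand K r (2 ^ r) E ⟩
    X ℕ.* 2 ℕ.* 2 ^ r ℕ.* (suc (r ℕ.+ K) ℕ.* E)               ≡⟨ cong (X ℕ.* 2 ℕ.* 2 ^ r ℕ.*_) absorb ⟨
    X ℕ.* 2 ℕ.* 2 ^ r ℕ.* (suc r ℕ.* E′)                      ≡⟨ regroup K r (2 ^ r) E′ ⟩
    suc r ℕ.* X ℕ.* (2 ^ suc r ℕ.* E′)                        ∎
    where
    X E E′ : ℕ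
    X  = 2 ℕ.* suc K ℕ.+ r
    E  = (r ℕ.+ K) C r
    E′ = (suc r ℕ.+ K) C suc r
    absorb : suc r ℕ.* E′ ≡ suc (r ℕ.+ K) ℕ.* E
    absorb = [k+1]*[n+1]C[k+1]≡[n+1]*nCk (r ℕ.+ K) r
    expand : ∀ K r p e → suc (r ℕ.+ suc (2 ℕ.* K)) ℕ.* (2 ℕ.* suc K ℕ.+ r ℕ.+ r) ℕ.* (p ℕ.* e)
                       ≡ (2 ℕ.* suc K ℕ.+ r) ℕ.* 2 ℕ.* p ℕ.* (suc (r ℕ.+ K) ℕ.* e)
    expand = solve-∀
    regroup : ∀ K r p e → (2 ℕ.* suc K ℕ.+ r) ℕ.* 2 ℕ.* p ℕ.* (suc r ℕ.* e)
                        ≡ suc r ℕ.* (2 ℕ.* suc K ℕ.+ r) ℕ.* (2 ℕ.* p ℕ.* e)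
    regroup = solve-∀

  evenSum-closedForm : ∀ K r N → r < 2 ℕ.* N →
    ⟦ (r ℕ.+ suc (2 ℕ.* K)) C r ⟧ * evenSum (suc K) r N ≡ ⟦ 2 ^ r ℕ.* ((r ℕ.+ K) C r) ⟧
  evenSum-closedForm K zero    (suc N) _      = trans (*-identityˡ _) (evenSum-zero (suc K) N)
  evenSum-closedForm K (suc r) N       1+r<2N = ⟦⟧-cancelˡ (suc r ℕ.* X) (begin
    ⟦ suc r ℕ.* X ⟧ * (⟦ D′ ⟧ * S′)
      ≡⟨ cong (_* (⟦ D′ ⟧ * S′)) (⟦⟧-homo-* (suc r) X) ⟩
    ⟦ suc r ⟧ * ⟦ X ⟧ * (⟦ D′ ⟧ * S′)
      ≡⟨ *-Props.interchange ⟦ suc r ⟧ ⟦ X ⟧ ⟦ D′ ⟧ S′ ⟩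
    ⟦ suc r ⟧ * ⟦ D′ ⟧ * (⟦ X ⟧ * S′)
      ≡⟨ cong₂ _*_ (sym (⟦⟧-homo-* (suc r) D′)) (evenSum-ratio (suc K) {r} {N} 1+r<2N) ⟩
    ⟦ suc r ℕ.* D′ ⟧ * (⟦ X ℕ.+ r ⟧ * S)
      ≡⟨ cong (λ n → ⟦ n ⟧ * (⟦ X ℕ.+ r ⟧ * S)) ([k+1]*[n+1]C[k+1]≡[n+1]*nCk (r ℕ.+ m) r) ⟩
    ⟦ suc (r ℕ.+ m) ℕ.* D ⟧ * (⟦ X ℕ.+ r ⟧ * S)
      ≡⟨ cong (_* (⟦ X ℕ.+ r ⟧ * S)) (⟦⟧-homo-* (suc (r ℕ.+ m)) D) ⟩
    ⟦ suc (r ℕ.+ m) ⟧ * ⟦ D ⟧ * (⟦ X ℕ.+ r ⟧ * S)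
      ≡⟨ *-Props.interchange ⟦ suc (r ℕ.+ m) ⟧ ⟦ D ⟧ ⟦ X ℕ.+ r ⟧ S ⟩
    ⟦ suc (r ℕ.+ m) ⟧ * ⟦ X ℕ.+ r ⟧ * (⟦ D ⟧ * S)
      ≡⟨ cong₂ _*_ (sym (⟦⟧-homo-* (suc (r ℕ.+ m)) (X ℕ.+ r))) (evenSum-closedForm K r N 1+r<2N⇒r<2N) ⟩
    ⟦ suc (r ℕ.+ m) ℕ.* (X ℕ.+ r) ⟧ * ⟦ 2 ^ r ℕ.* E ⟧
      ≡⟨ ⟦⟧-homo-* (suc (r ℕ.+ m) ℕ.* (X ℕ.+ r)) (2 ^ r ℕ.* E) ⟨
    ⟦ suc (r ℕ.+ m) ℕ.* (X ℕ.+ r) ℕ.* (2 ^ r ℕ.* E) ⟧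
      ≡⟨ cong ⟦_⟧ (closedForm-step K r) ⟩
    ⟦ suc r ℕ.* X ℕ.* (2 ^ suc r ℕ.* E′) ⟧
      ≡⟨ ⟦⟧-homo-* (suc r ℕ.* X) (2 ^ suc r ℕ.* E′) ⟩
    ⟦ suc r ℕ.* X ⟧ * ⟦ 2 ^ suc r ℕ.* E′ ⟧ ∎)
    where
    m X D D′ E E′ : ℕ
    m  = suc (2 ℕ.* K)
    X  = 2 ℕ.* suc K ℕ.+ r
    D  = (r ℕ.+ m) C r
    D′ = (suc r ℕ.+ m) C suc r
    E  = (r ℕ.+ K) C r
    E′ = (suc r ℕ.+ K) C suc r
    S S′ : ℚ
    S  = evenSum (suc K) r N
    S′ = evenSum (suc K) (suc r) N
    1+r<2N⇒r<2N : r < 2 ℕ.* N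
    1+r<2N⇒r<2N = ℕ.<-trans (ℕ.n<1+n r) 1+r<2N

open Embedding using (⟦d⟧*x≡⟦a⟧⇒x≡a/d)
open Sums using (Σℚ-cong)
open EvenSums using (term≡C*oddRatio; evenSum; evenSum-closedForm)
open import Data.Nat using (ℕ; suc; _≤_; _<_; _/_; _+_; _*_; _∸_; _^_; _%_; z≤n; s≤s)
open import Data.Nat.Combinatorics using (_C_)
open import Data.Nat.DivMod using (m≡m%n+[m/n]*n; m%n<n)
open import Data.Nat.Properties using (+-suc; +-monoˡ-<; module ≤-Reasoning)
open import Data.Nat.Tactic.RingSolver using (solve-∀)
import Data.Rational as ℚ
open import Relation.Binary.PropositionalEquality using (_≡_; trans; cong; cong₂; module ≡-Reasoning)

m<2[m/2+1] : ∀ m → m < 2 * (m / 2 + 1)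
m<2[m/2+1] m = begin-strict
  m                  ≡⟨ m≡m%n+[m/n]*n m 2 ⟩
  m % 2 + m / 2 * 2  <⟨ +-monoˡ-< (m / 2 * 2) (m%n<n m 2) ⟩
  2 + m / 2 * 2      ≡⟨ double (m / 2) ⟩
  2 * (m / 2 + 1)    ∎
  where
  open ≤-Reasoning
  double : ∀ q → 2 + q * 2 ≡ 2 * (q + 1)
  double = solve-∀

-- The identity also holds for r = 0.
lemmaA2 : (r κ : ℕ) → 1 ≤ r → (1≤κ : 1 ≤ κ) →
    Σℚ (r / 2 + 1) (λ l → term r κ l) ≡ rhs r κ 1≤κ
lemmaA2 r (suc K) _ 1≤κ@(s≤s z≤n) =
  ⟦d⟧*x≡⟦a⟧⇒x≡a/d A D {{C-nonZero _ r (r≤r+2κ∸1 r (suc K) 1≤κ)}} (begin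
    ⟦ D ⟧ ℚ.* Σℚ N (term r (suc K))
      ≡⟨ cong₂ (λ n S → ⟦ n C r ⟧ ℚ.* S) r+2κ∸1≡r+2K+1 (Σℚ-cong N (term≡C*oddRatio r (suc K))) ⟩
    ⟦ (r + suc (2 * K)) C r ⟧ ℚ.* evenSum (suc K) r N
      ≡⟨ evenSum-closedForm K r N (m<2[m/2+1] r) ⟩
    ⟦ 2 ^ r * ((r + K) C r) ⟧
      ≡⟨ cong (λ n → ⟦ 2 ^ r * (n C r) ⟧) (cong (_∸ 1) (+-suc r K)) ⟨
    ⟦ A ⟧ ∎)
  where
  open ≡-Reasoning
  N A D : ℕ
  N = r / 2 + 1
  A = 2 ^ r * ((r + suc K ∸ 1) C r)
  D = (r + 2 * suc K ∸ 1) C r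
  r+2κ∸1≡r+2K+1 : r + 2 * suc K ∸ 1 ≡ r + suc (2 * K)
  r+2κ∸1≡r+2K+1 = trans (cong (_∸ 1) (+-suc r (K + suc (K + 0)))) (cong (r +_) (+-suc K (K + 0)))
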